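{- Let $G$ be a $(k,t)$-regular graph and let $x$ be a vertex of $G$ such that the complement $\overline{G_x}$ of the local graph at $x$ is far-connected. Then $x$ has exactly $k-t$ twins in $G$ (counting $x$ itself).
   Context: All graphs are simple, possibly infinite, but with finite valency. For a vertex $v$ of a graph $G$, the local graph $G_v$ is the subgraph of $G$ induced on the neighbourhood $N(v)$. A graph $G$ is $(k,t)$-regular if it is $k$-regular and every local graph $G_v$ is $t$-regular. For a graph $H$, let $H^{\geq 3}$ be the graph on the same vertex set in which two vertices are adjacent iff their distance in $H$ is at least $3$ (including infinite distance); $H$ is far-connected if $H^{\geq 3}$ is connected. Vertices $x,y$ of $G$ are twins if $N(x)=N(y)$; in particular $x$ is a twin of itself. -}

module Defs where

open import Data.Nat using (ℕ; _∸_)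
open import Data.List using (List; length)
open import Data.List.Membership.Propositional using (_∈_)
open import Data.List.Relation.Unary.Unique.Propositional using (Unique)
open import Data.Product using (Σ; _×_; _,_; proj₁)
open import Data.Sum using (_⊎_)
open import Relation.Nullary using (¬_)
open import Relation.Binary.PropositionalEquality using (_≡_)
open import Relation.Binary.Construct.Closure.ReflexiveTransitive using (Star)
open import Function.Bundles using (_⇔_)

record Graph : Set₁ where
  field
    V       : Set
    _~_     : V → V → Set
    ~-sym   : ∀ {u v} → u ~ v → v ~ u
    ~-irrefl : ∀ {v} → ¬ (v ~ v)
    ~-prop  : ∀ {u v} (p q : u ~ v) → p ≡ q

HasSize : {A : Set} → (A → Set) → ℕ → Set
HasSize {A} P n = Σ (List A) λ l → (length l ≡ n) × Unique l × (∀ a → P a ⇔ (a ∈ l))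

module _ (G : Graph) where
  open Graph G

  N : V → V → Set
  N v w = v ~ w

  Regular : ℕ → Set
  Regular k = ∀ v → HasSize (N v) k

  LocalV : V → Set
  LocalV v = Σ V (N v)

  LocalAdj : (v : V) → LocalV v → LocalV v → Set
  LocalAdj v a b = proj₁ a ~ proj₁ b

  LocallyRegular : ℕ → Set
  LocallyRegular t = ∀ v (a : LocalV v) → HasSize (LocalAdj v a) t

  KTRegular : ℕ → ℕ → Set
  KTRegular k t = Regular k × LocallyRegular t

  CoLocalAdj : (v : V) → LocalV v → LocalV v → Set
  CoLocalAdj v a b = ¬ (a ≡ b) × ¬ (LocalAdj v a b)

  Twins : V → V → Set
  Twins x y = ∀ z → (x ~ z) ⇔ (y ~ z)

-- For a graph H on W with adjacency R: u,w have distance ≥ 3 in H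
-- (including infinite distance) iff distance is not 0, 1 or 2.
Far : {W : Set} → (W → W → Set) → W → W → Set
Far {W} R u w = ¬ ((u ≡ w) ⊎ R u w ⊎ Σ W (λ z → R u z × R z w))

Connected : (W : Set) → (W → W → Set) → Set
Connected W R = W × (∀ u w → Star R u w)

FarConnected : (W : Set) → (W → W → Set) → Set
FarConnected W R = Connected W (Far R)

-- Fix a neighbour y of x.  A twin of x lies in N(y) ∖ N(x), a set of k - t vertices;
-- the work is the converse.  If a, b ∈ N(x) are at distance ≥ 3 in the complement
-- of G_x, then a ~ b and every vertex of N(x) is adjacent to a or b, so
-- k ≤ t + |(N(b) ∩ N(x)) ∖ N(a)|.  That difference has the size of
-- (N(b) ∩ N(a)) ∖ N(x), as N(b) ∩ N(x) and N(b) ∩ N(a) both have t elements; hence a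
-- vertex of N(a) ∖ N(x) outside N(b) would give N(a) more than k elements.  So
-- N(a) ∖ N(x) ⊆ N(b), and far-connectivity carries this from y to all of N(x): every
-- z ∈ N(y) ∖ N(x) has N(x) ⊆ N(z), with equality since both have k elements.
module Submission where

open import Data.Empty using (⊥-elim)
open import Data.Fin using (zero; suc)
open import Data.Fin.Properties using (injective⇒≤)
open import Data.List using (List; []; _∷_; [_]; length; lookup; map; _++_)
open import Data.List.Properties using (length-map; length-++)
open import Data.List.Membership.Propositional using (_∈_)
open import Data.List.Membership.Propositional.Properties
  using (∈-lookup; ∈-map⁺; ∈-map⁻; ∈-++⁺ˡ; ∈-++⁺ʳ; ∈-++⁻)
open import Data.List.Membership.Setoid.Properties using (index-injective)
open import Data.List.Relation.Unary.All as All using ([])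
open import Data.List.Relation.Unary.AllPairs using ([]; _∷_)
open import Data.List.Relation.Unary.Any as Any using (here; there)
open import Data.List.Relation.Unary.Unique.Propositional using (Unique)
open import Data.List.Relation.Unary.Unique.Propositional.Properties using (++⁺; map⁺)
open import Data.Nat using (ℕ; suc; _+_; _∸_; _≤_)
open import Data.Nat.Properties using (≤-antisym; ≤-trans; n≮n; 1+n≰n; m+n∸m≡n; +-suc)
open import Data.Product using (Σ; ∃; ∃₂; _×_; _,_; proj₁; proj₂; swap)
open import Data.Sum as Sum using (inj₁; inj₂; [_,_]′)
open import Function using (_∘_)
open import Function.Bundles using (Equivalence; mk⇔)
open import Level using (0ℓ)
open import Relation.Binary.Construct.Closure.ReflexiveTransitive using (Star; fold)
open import Relation.Binary.PropositionalEquality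
  using (_≡_; _≢_; refl; sym; trans; cong; cong₂; subst; setoid)
open import Relation.Nullary using (¬_; Dec; yes; no)
open import Relation.Nullary.Decidable using (map′; _⊎-dec_)
open import Relation.Unary using (Pred; ∁; ｛_｝; _⊆_; _≐_; _∩_; _∪_; _∖_; _⊥_)
open import Relation.Unary.Properties using (≐-refl)

open import Defs

open Equivalence using (to; from)

module _ {A : Set} where

  private variable
    x y : A
    xs ys : List A
    m n : ℕ
    P Q R S : Pred A 0ℓ

  lookup-injective : Unique xs → ∀ {i j} → lookup xs i ≡ lookup xs j → i ≡ j
  lookup-injective (_ ∷ _)   {zero}  {zero}  _  = refl
  lookup-injective (x∉ ∷ _)  {zero}  {suc j} eq = ⊥-elim (All.lookup x∉ (∈-lookup j) eq)
  lookup-injective (x∉ ∷ _)  {suc i} {zero}  eq = ⊥-elim (All.lookup x∉ (∈-lookup i) (sym eq))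
  lookup-injective (_ ∷ xs!) {suc i} {suc j} eq = cong suc (lookup-injective xs! eq)

  Unique-⊆⇒length≤ : Unique xs → (_∈ xs) ⊆ (_∈ ys) → length xs ≤ length ys
  Unique-⊆⇒length≤ xs! xs⊆ys = injective⇒≤ λ {i} {j} eq →
    lookup-injective xs! (index-injective (setoid A) (xs⊆ys (∈-lookup i)) (xs⊆ys (∈-lookup j)) eq)

  ∈-Unique-≟ : Unique xs → x ∈ xs → y ∈ xs → Dec (x ≡ y)
  ∈-Unique-≟ _          (here refl) (here refl) = yes refl
  ∈-Unique-≟ (x∉ ∷ _)   (here refl) (there y∈)  = no (All.lookup x∉ y∈)
  ∈-Unique-≟ (y∉ ∷ _)   (there x∈)  (here refl) = no (All.lookup y∉ x∈ ∘ sym)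
  ∈-Unique-≟ (_ ∷ xs!)  (there x∈)  (there y∈)  = ∈-Unique-≟ xs! x∈ y∈

  ∈?-⊆ : Unique ys → (_∈ xs) ⊆ (_∈ ys) → y ∈ ys → Dec (y ∈ xs)
  ∈?-⊆ {xs = []}    _   _     _   = no λ ()
  ∈?-⊆ {xs = _ ∷ _} ys! xs⊆ys y∈ = map′ Any.fromSum Any.toSum
    (∈-Unique-≟ ys! y∈ (xs⊆ys (here refl)) ⊎-dec ∈?-⊆ ys! (xs⊆ys ∘ there) y∈)

  HasSize-resp-≐ : P ≐ Q → HasSize P n → HasSize Q n
  HasSize-resp-≐ (P⊆Q , Q⊆P) (xs , |xs| , xs! , P⇔) =
    xs , |xs| , xs! , λ a → mk⇔ (to (P⇔ a) ∘ Q⊆P) (P⊆Q ∘ from (P⇔ a))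

  HasSize-mono : P ⊆ Q → HasSize P m → HasSize Q n → m ≤ n
  HasSize-mono P⊆Q (xs , refl , xs! , P⇔) (ys , refl , _ , Q⇔) =
    Unique-⊆⇒length≤ xs! λ {a} → to (Q⇔ a) ∘ P⊆Q ∘ from (P⇔ a)

  HasSize-cong : P ≐ Q → HasSize P m → HasSize Q n → m ≡ n
  HasSize-cong (P⊆Q , Q⊆P) hP hQ = ≤-antisym (HasSize-mono P⊆Q hP hQ) (HasSize-mono Q⊆P hQ hP)

  HasSize-∈? : HasSize P m → HasSize Q n → Q ⊆ P → ∀ {a} → P a → Dec (Q a)
  HasSize-∈? (xs , _ , xs! , P⇔) (ys , _ , _ , Q⇔) Q⊆P {a} pa =
    map′ (from (Q⇔ a)) (to (Q⇔ a))
      (∈?-⊆ xs! (λ {b} → to (P⇔ b) ∘ Q⊆P ∘ from (Q⇔ b)) (to (P⇔ a) pa))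

  HasSize-∅ : (∀ a → ¬ P a) → HasSize P 0
  HasSize-∅ ¬P = [] , refl , [] , λ a → mk⇔ (⊥-elim ∘ ¬P a) λ ()

  HasSize-｛｝ : HasSize ｛ x ｝ 1
  HasSize-｛｝ {x} = [ x ] , refl , [] ∷ [] , λ _ → mk⇔ (here ∘ sym) λ { (here refl) → refl }

  HasSize-∪ : P ⊥ Q → HasSize P m → HasSize Q n → HasSize (P ∪ Q) (m + n)
  HasSize-∪ P⊥Q (xs , refl , xs! , P⇔) (ys , refl , ys! , Q⇔) =
    xs ++ ys , length-++ xs , ++⁺ xs! ys! disjoint ,
    λ a → mk⇔ [ ∈-++⁺ˡ ∘ to (P⇔ a) , ∈-++⁺ʳ xs ∘ to (Q⇔ a) ]′
              (Sum.map (from (P⇔ a)) (from (Q⇔ a)) ∘ ∈-++⁻ xs)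
    where
      disjoint : ∀ {a} → ¬ (a ∈ xs × a ∈ ys)
      disjoint {a} (a∈xs , a∈ys) = P⊥Q (from (P⇔ a) a∈xs , from (Q⇔ a) a∈ys)

  private
    ∷-∩-member : S x → (｛ x ｝ ∪ ((_∈ xs) ∩ S)) ≐ ((_∈ x ∷ xs) ∩ S)
    ∷-∩-member sx = (λ { (inj₁ refl) → here refl , sx ; (inj₂ (a∈ , sa)) → there a∈ , sa })
                  , (λ { (here refl , _) → inj₁ refl ; (there a∈ , sa) → inj₂ (a∈ , sa) })

    ∷-∩-nonmember : ¬ S x → ((_∈ xs) ∩ S) ≐ ((_∈ x ∷ xs) ∩ S)
    ∷-∩-nonmember ¬sx = (λ (a∈ , sa) → there a∈ , sa)
                      , (λ { (here refl , sx) → ⊥-elim (¬sx sx) ; (there a∈ , sa) → a∈ , sa })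

  ∈-split : Unique xs → (∀ {a} → a ∈ xs → Dec (Q a)) →
            ∃₂ λ i j → i + j ≡ length xs × HasSize ((_∈ xs) ∩ Q) i × HasSize ((_∈ xs) ∖ Q) j
  ∈-split {xs = []} _ _ = 0 , 0 , refl , HasSize-∅ (λ _ ()) , HasSize-∅ (λ _ ())
  ∈-split {xs = x ∷ xs} {Q} (x∉ ∷ xs!) Q? with ∈-split xs! (Q? ∘ there) | Q? (here refl)
  ... | i , j , i+j , hQ , h¬Q | yes qx =
    suc i , j , cong suc i+j ,
    HasSize-resp-≐ (∷-∩-member qx) (HasSize-∪ fresh HasSize-｛｝ hQ) ,
    HasSize-resp-≐ (∷-∩-nonmember (λ ¬qx → ¬qx qx)) h¬Q
    where
      fresh : ｛ x ｝ ⊥ ((_∈ xs) ∩ Q)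
      fresh (refl , x∈ , _) = All.lookup x∉ x∈ refl
  ... | i , j , i+j , hQ , h¬Q | no ¬qx =
    i , suc j , trans (+-suc i j) (cong suc i+j) ,
    HasSize-resp-≐ (∷-∩-nonmember ¬qx) hQ ,
    HasSize-resp-≐ (∷-∩-member ¬qx) (HasSize-∪ fresh HasSize-｛｝ h¬Q)
    where
      fresh : ｛ x ｝ ⊥ ((_∈ xs) ∖ Q)
      fresh (refl , x∈ , _) = All.lookup x∉ x∈ refl

  HasSize-split : HasSize P n → (∀ {a} → P a → Dec (Q a)) →
                  ∃₂ λ i j → i + j ≡ n × HasSize (P ∩ Q) i × HasSize (P ∖ Q) j
  HasSize-split {P} {Q = Q} (xs , refl , xs! , P⇔) Q? =
    let i , j , i+j , hQ , h¬Q = ∈-split xs! (Q? ∘ from (P⇔ _))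
    in i , j , i+j , HasSize-resp-≐ (∈-∩≐P-∩ Q) hQ , HasSize-resp-≐ (∈-∩≐P-∩ (∁ Q)) h¬Q
    where
      ∈-∩≐P-∩ : ∀ (T : Pred A 0ℓ) → ((_∈ xs) ∩ T) ≐ (P ∩ T)
      ∈-∩≐P-∩ _ = (λ (a∈ , ta) → from (P⇔ _) a∈ , ta) , (λ (pa , ta) → to (P⇔ _) pa , ta)

  HasSize-∖ : HasSize P n → HasSize (P ∩ Q) m → (∀ {a} → P a → Dec (Q a)) → HasSize (P ∖ Q) (n ∸ m)
  HasSize-∖ {P} {n} {Q} {m} hP hPQ Q? =
    let i , j , i+j≡n , hPQ′ , hP∖Q = HasSize-split hP Q?
        j≡n∸m : j ≡ n ∸ m
        j≡n∸m = trans (sym (m+n∸m≡n i j)) (cong₂ _∸_ i+j≡n (HasSize-cong ≐-refl hPQ′ hPQ))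
    in subst (HasSize (P ∖ Q)) j≡n∸m hP∖Q

  HasSize-∖-swap : HasSize (R ∩ P) n → HasSize (R ∩ Q) n →
                   (∀ {a} → (R ∩ P) a → Dec (Q a)) → (∀ {a} → (R ∩ Q) a → Dec (P a)) →
                   ∃ λ e → HasSize ((R ∩ P) ∖ Q) e × HasSize ((R ∩ Q) ∖ P) e
  HasSize-∖-swap {R} {P} {Q = Q} hRP hRQ Q? P? =
    let _ , _ , _ , hRPQ , _ = HasSize-split hRP Q?
        hRQP = HasSize-resp-≐ (exchange {R} {P} {Q} , exchange {R} {Q} {P}) hRPQ
    in _ , HasSize-∖ hRP hRPQ Q? , HasSize-∖ hRQ hRQP P?
    where
      exchange : ∀ {U V W : Pred A 0ℓ} → ((U ∩ V) ∩ W) ⊆ ((U ∩ W) ∩ V)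
      exchange ((u , v) , w) = (u , w) , v

  HasSize-⊆⇒⊇ : P ⊆ Q → HasSize P n → HasSize Q n → Q ⊆ P
  HasSize-⊆⇒⊇ {P} {Q} P⊆Q hP hQ {a} qa with HasSize-∈? hQ hP P⊆Q qa
  ... | yes pa = pa
  ... | no ¬pa = ⊥-elim (1+n≰n (HasSize-mono a∪P⊆Q (HasSize-∪ fresh HasSize-｛｝ hP) hQ))
    where
      fresh : ｛ a ｝ ⊥ P
      fresh (refl , pa) = ¬pa pa
      a∪P⊆Q : (｛ a ｝ ∪ P) ⊆ Q
      a∪P⊆Q (inj₁ refl) = qa
      a∪P⊆Q (inj₂ pb)   = P⊆Q pb

  HasSize-proj₁ : {B : Pred A 0ℓ} → (∀ {a} (p q : B a) → p ≡ q) →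
                  {C : Pred (Σ A B) 0ℓ} → HasSize C n →
                  HasSize (λ a → Σ (B a) λ p → C (a , p)) n
  HasSize-proj₁ {B = B} B-prop {C} (xs , refl , xs! , C⇔) =
    map proj₁ xs , length-map proj₁ xs , map⁺ proj₁-injective xs! ,
    λ a → mk⇔ (λ (p , r) → ∈-map⁺ proj₁ (to (C⇔ (a , p)) r))
              (unpack ∘ ∈-map⁻ proj₁)
    where
      unpack : ∀ {a} → ∃ (λ u → u ∈ xs × a ≡ proj₁ u) → Σ (B a) λ p → C (a , p)
      unpack ((b , p) , b∈ , refl) = p , from (C⇔ (b , p)) b∈
      proj₁-injective : ∀ {u w} → proj₁ u ≡ proj₁ w → u ≡ w
      proj₁-injective {a , p} {.a , q} refl = cong (a ,_) (B-prop p q)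

module _ {G : Graph} where
  open Graph G

  common-neighbourhood-size : ∀ {t v u} → LocallyRegular G t → v ~ u → HasSize (N G v ∩ N G u) t
  common-neighbourhood-size {v = v} {u} loc vu = HasSize-proj₁ ~-prop (loc v (u , vu))

  module _ {k t : ℕ} (kt : KTRegular G k t) where
    private
      reg : Regular G k
      reg = proj₁ kt
      loc : LocallyRegular G t
      loc = proj₂ kt

    -- V has no decidable equality; the finite list of N(v) ∩ N(u) inside that of N(v) decides.
    adjacent? : ∀ {v u w} → v ~ u → v ~ w → Dec (u ~ w)
    adjacent? {v} vu vw =
      map′ proj₂ (vw ,_) (HasSize-∈? (reg v) (common-neighbourhood-size loc vu) proj₁ vw)

    module _ {x a b : V} {xa : x ~ a} {xb : x ~ b} (far : Far (CoLocalAdj G x) (a , xa) (b , xb)) where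

      far⇒adjacent : a ~ b
      far⇒adjacent with adjacent? xa xb
      ... | yes ab = ab
      ... | no ¬ab = ⊥-elim (far (inj₂ (inj₁ (far ∘ inj₁ , ¬ab))))

      far⇒N[x]-cover : N G x ⊆ (N G x ∩ N G a) ∪ ((N G b ∩ N G x) ∖ N G a)
      far⇒N[x]-cover {w} xw with adjacent? xa xw | adjacent? xb xw
      ... | yes aw | _      = inj₁ (xw , aw)
      ... | no ¬aw | yes bw = inj₂ ((bw , xw) , ¬aw)
      ... | no ¬aw | no ¬bw = ⊥-elim (far (inj₂ (inj₂ ((w , xw) , (a≢w , ¬aw) , (w≢b , ¬bw ∘ ~-sym)))))
        where
          a≢w : (a , xa) ≢ (w , xw)
          a≢w refl = ¬bw (~-sym far⇒adjacent)
          w≢b : (w , xw) ≢ (b , xb)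
          w≢b refl = ¬aw far⇒adjacent

      far⇒k≤t+|N[b]∩N[x]∖N[a]| : ∀ {e} → HasSize ((N G b ∩ N G x) ∖ N G a) e → k ≤ t + e
      far⇒k≤t+|N[b]∩N[x]∖N[a]| hE =
        HasSize-mono far⇒N[x]-cover (reg x) (HasSize-∪ disjoint (common-neighbourhood-size loc xa) hE)
        where
          disjoint : (N G x ∩ N G a) ⊥ ((N G b ∩ N G x) ∖ N G a)
          disjoint ((_ , aw) , _ , ¬aw) = ¬aw aw

    1+t+|N[b]∩N[a]∖N[x]|≤k : ∀ {x a b c e} → a ~ x → (N G a ∖ N G x) c → ¬ b ~ c →
                              HasSize ((N G b ∩ N G a) ∖ N G x) e → suc (t + e) ≤ k
    1+t+|N[b]∩N[a]∖N[x]|≤k {x} {a} {b} {c} ax (ac , ¬xc) ¬bc hE =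
      HasSize-mono c∪N[a]-parts⊆N[a]
        (HasSize-∪ c-fresh HasSize-｛｝ (HasSize-∪ disjoint (common-neighbourhood-size loc ax) hE))
        (reg a)
      where
        c∪N[a]-parts⊆N[a] : (｛ c ｝ ∪ (N G a ∩ N G x) ∪ ((N G b ∩ N G a) ∖ N G x)) ⊆ N G a
        c∪N[a]-parts⊆N[a] (inj₁ refl)                   = ac
        c∪N[a]-parts⊆N[a] (inj₂ (inj₁ (aw , _)))        = aw
        c∪N[a]-parts⊆N[a] (inj₂ (inj₂ ((_ , aw) , _))) = aw
        c-fresh : ｛ c ｝ ⊥ ((N G a ∩ N G x) ∪ ((N G b ∩ N G a) ∖ N G x))
        c-fresh (refl , inj₁ (_ , xc))        = ¬xc xc
        c-fresh (refl , inj₂ ((bc , _) , _)) = ¬bc bc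
        disjoint : (N G a ∩ N G x) ⊥ ((N G b ∩ N G a) ∖ N G x)
        disjoint ((_ , xw) , _ , ¬xw) = ¬xw xw

    far⇒N[a]∖N[x]⊆N[b] : ∀ {x a b} {xa : x ~ a} {xb : x ~ b} → Far (CoLocalAdj G x) (a , xa) (b , xb) →
                         N G a ∖ N G x ⊆ N G b
    far⇒N[a]∖N[x]⊆N[b] {x} {a} {b} {xa} {xb} far {c} c∈@(ac , _) with adjacent? (far⇒adjacent far) ac
    ... | yes bc = bc
    ... | no ¬bc =
      let ab = far⇒adjacent far
          e , hE , hE′ = HasSize-∖-swap (common-neighbourhood-size loc (~-sym xb))
                                        (common-neighbourhood-size loc (~-sym ab))
                                        (λ (_ , xw) → adjacent? xa xw) (λ (_ , aw) → adjacent? (~-sym xa) aw)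
      in ⊥-elim (n≮n (t + e) (≤-trans (1+t+|N[b]∩N[a]∖N[x]|≤k (~-sym xa) c∈ ¬bc hE′)
                                       (far⇒k≤t+|N[b]∩N[x]∖N[a]| far hE)))

    walk⇒N[u]∖N[x]⊆N[w] : ∀ {x} {u w : LocalV G x} → Star (Far (CoLocalAdj G x)) u w →
                          N G (proj₁ u) ∖ N G x ⊆ N G (proj₁ w) ∖ N G x
    walk⇒N[u]∖N[x]⊆N[w] {x} = fold (λ u w → N G (proj₁ u) ∖ N G x ⊆ N G (proj₁ w) ∖ N G x)
                                   (λ far ⊆rest c∈ → ⊆rest (far⇒N[a]∖N[x]⊆N[b] far c∈ , proj₂ c∈))
                                   (λ c∈ → c∈)

    twins≐N[y]∖N[x] : ∀ {x y} → FarConnected (LocalV G x) (CoLocalAdj G x) → x ~ y →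
                      Twins G x ≐ N G y ∖ N G x
    twins≐N[y]∖N[x] {x} {y} (_ , walk) xy = twin⇒ , ⇒twin
      where
        twin⇒ : Twins G x ⊆ N G y ∖ N G x
        twin⇒ {z} tw = ~-sym (to (tw y) xy) , λ xz → ~-irrefl (to (tw z) xz)
        ⇒twin : N G y ∖ N G x ⊆ Twins G x
        ⇒twin {z} z∈ w = mk⇔ N[x]⊆N[z] (HasSize-⊆⇒⊇ N[x]⊆N[z] (reg x) (reg z))
          where
            N[x]⊆N[z] : N G x ⊆ N G z
            N[x]⊆N[z] {w} xw = ~-sym (proj₁ (walk⇒N[u]∖N[x]⊆N[w] (walk (y , xy) (w , xw)) z∈))

    N[y]∖N[x]-size : ∀ {x y} → x ~ y → HasSize (N G y ∖ N G x) (k ∸ t)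
    N[y]∖N[x]-size {y = y} xy =
      HasSize-∖ (reg y) (common-neighbourhood-size loc (~-sym xy)) (adjacent? (~-sym xy))

proposition4p7 : (G : Graph) (k t : ℕ) → KTRegular G k t →
    (x : Graph.V G) → FarConnected (LocalV G x) (CoLocalAdj G x) →
    HasSize (Twins G x) (k ∸ t)
proposition4p7 G k t kt x far-connected@((y , xy) , _) =
  HasSize-resp-≐ (swap (twins≐N[y]∖N[x] {G} kt far-connected xy)) (N[y]∖N[x]-size {G} kt xy)
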